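{- Let $(\mathcal{C},T,C,\succeq)$ be a target–context category and $s\colon P\otimes C\to T\otimes C$ a simulator. Assume that every functional $r\colon T\to P$ with $s\circ(r\otimes\mathrm{id}_C)\succeq\mathrm{id}_{T\otimes C}$ also satisfies $\mathrm{id}_{T\otimes C}\succeq s\circ(r\otimes\mathrm{id}_C)$. If $s$ is compressed, then there is no simulator morphism from $s$ to the trivial simulator $\mathrm{id}_{T\otimes C}$.
   Context: A gs-monoidal category is a symmetric monoidal category $\mathcal{C}$ (tensor $\otimes$, unit $I$, unitors suppressed) in which every object $A$ carries $\mathrm{copy}_A\colon A\to A\otimes A$, $\mathrm{del}_A\colon A\to I$ forming a commutative comonoid, compatible with $\otimes$, with $\mathrm{del}_I=\mathrm{id}_I$. For $f\colon A\to X$: $\mathrm{dom}(f):=(\mathrm{id}_A\otimes(\mathrm{del}_X\circ f))\circ\mathrm{copy}_A$; $f$ is normalized if $f\circ\mathrm{dom}(f)=f$; functional if $\mathrm{copy}_X\circ f=(f\otimes f)\circ\mathrm{copy}_A$. $f\sqsupseteq g$ means $f\circ\mathrm{dom}(g)=g$. A target–context category $(\mathcal{C},T,C,\succeq)$: a gs-monoidal category with all morphisms normalized, objects $T,C$, and a preorder $\succeq$ on each $\mathcal{C}(A,T\otimes C)$ with $f\sqsupseteq g\Rightarrow f\succeq g$ and $f\succeq g\Rightarrow f\circ h\succeq g\circ h$. A simulator with programs $P$ is $s\colon P\otimes C\to T\otimes C$ such that there are a functional $s_T\colon P\to T$ (compiler) and $s_C\colon P\otimes C\to C$ with $s=(s_T\otimes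 s_C)\circ(\mathrm{copy}_P\otimes\mathrm{id}_C)$, $(\mathrm{id}_T\otimes\mathrm{del}_C)\circ s=s_T\otimes\mathrm{del}_C$, $(\mathrm{del}_T\otimes\mathrm{id}_C)\circ s=s_C$. It is universal if some functional $r\colon T\to P$ (a lax reduction to the trivial simulator) satisfies $s\circ(r\otimes\mathrm{id}_C)\succeq\mathrm{id}_{T\otimes C}$. The trivial simulator is $\mathrm{id}_{T\otimes C}$ with programs $T$. A universal simulator $s$ is compressed if for every such lax reduction $r$ there are functional states $t,g\colon I\to T$ with (i) $s_T\circ r\circ t=s_T\circ r\circ g$, and (ii) there is no morphism $v\colon C\to C$ with $g\otimes\mathrm{id}_C\succeq t\otimes v$. For simulators $s$ (programs $P$) and $s'$ (programs $P'$), a simulator morphism $s\to s'$ is a pair $(r,q)$ of a functional $r\colon P'\to P$ and $q\colon P'\otimes T\otimes C\to T\otimes C$ such that: (i) $q$ is a simulator with programs $P'\otimes T$; (ii) $\mathrm{del}_{P'}\otimes\mathrm{id}_{T\otimes C}\succeq q$; (iii) $s'=q\circ(\mathrm{id}_{P'}\otimes(s\circ(r\otimes\mathrm{id}_C)))\circ(\mathrm{copy}_{P'}\otimes\mathrm{id}_C)$. -}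

module Defs where

open import Level using (Level; _⊔_; suc)
open import Relation.Binary using (Rel; IsEquivalence)
open import Relation.Nullary using (¬_)
open import Data.Product using (Σ; ∃; _×_; _,_)

record GSMonoidal (o ℓ e : Level) : Set (suc (o ⊔ ℓ ⊔ e)) where
  infixr 9 _∘_
  infixr 10 _⊗₀_ _⊗₁_
  infix 4 _≈_
  field
    Obj  : Set o
    Hom  : Obj → Obj → Set ℓ
    _≈_  : ∀ {A B} → Rel (Hom A B) e
    ≈-equiv : ∀ {A B} → IsEquivalence (_≈_ {A} {B})
    id   : ∀ {A} → Hom A A
    _∘_  : ∀ {A B D} → Hom B D → Hom A B → Hom A D
    ∘-resp-≈ : ∀ {A B D} {f f′ : Hom B D} {g g′ : Hom A B} →
               f ≈ f′ → g ≈ g′ → f ∘ g ≈ f′ ∘ g′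
    assoc : ∀ {A B D E} {f : Hom D E} {g : Hom B D} {h : Hom A B} →
            (f ∘ g) ∘ h ≈ f ∘ (g ∘ h)
    identityˡ : ∀ {A B} {f : Hom A B} → id ∘ f ≈ f
    identityʳ : ∀ {A B} {f : Hom A B} → f ∘ id ≈ f

    _⊗₀_ : Obj → Obj → Obj
    _⊗₁_ : ∀ {A B A′ B′} → Hom A A′ → Hom B B′ → Hom (A ⊗₀ B) (A′ ⊗₀ B′)
    ⊗-resp-≈ : ∀ {A B A′ B′} {f f′ : Hom A A′} {g g′ : Hom B B′} →
               f ≈ f′ → g ≈ g′ → f ⊗₁ g ≈ f′ ⊗₁ g′
    ⊗-id : ∀ {A B} → id {A} ⊗₁ id {B} ≈ id
    ⊗-∘  : ∀ {A B D A′ B′ D′} {f : Hom B D} {g : Hom A B}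
             {f′ : Hom B′ D′} {g′ : Hom A′ B′} →
           (f ∘ g) ⊗₁ (f′ ∘ g′) ≈ (f ⊗₁ f′) ∘ (g ⊗₁ g′)
    I    : Obj
    λ⇒   : ∀ {A} → Hom (I ⊗₀ A) A
    λ⇐   : ∀ {A} → Hom A (I ⊗₀ A)
    ρ⇒   : ∀ {A} → Hom (A ⊗₀ I) A
    ρ⇐   : ∀ {A} → Hom A (A ⊗₀ I)
    α⇒   : ∀ {A B D} → Hom ((A ⊗₀ B) ⊗₀ D) (A ⊗₀ (B ⊗₀ D))
    α⇐   : ∀ {A B D} → Hom (A ⊗₀ (B ⊗₀ D)) ((A ⊗₀ B) ⊗₀ D)
    σ    : ∀ {A B} → Hom (A ⊗₀ B) (B ⊗₀ A)
    λ-iso₁ : ∀ {A} → λ⇒ {A} ∘ λ⇐ ≈ id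
    λ-iso₂ : ∀ {A} → λ⇐ {A} ∘ λ⇒ ≈ id
    ρ-iso₁ : ∀ {A} → ρ⇒ {A} ∘ ρ⇐ ≈ id
    ρ-iso₂ : ∀ {A} → ρ⇐ {A} ∘ ρ⇒ ≈ id
    α-iso₁ : ∀ {A B D} → α⇒ {A} {B} {D} ∘ α⇐ ≈ id
    α-iso₂ : ∀ {A B D} → α⇐ {A} {B} {D} ∘ α⇒ ≈ id
    σ-invol : ∀ {A B} → σ {B} {A} ∘ σ {A} {B} ≈ id
    λ-natural : ∀ {A B} {f : Hom A B} → f ∘ λ⇒ ≈ λ⇒ ∘ (id ⊗₁ f)
    ρ-natural : ∀ {A B} {f : Hom A B} → f ∘ ρ⇒ ≈ ρ⇒ ∘ (f ⊗₁ id)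
    α-natural : ∀ {A B D A′ B′ D′} {f : Hom A A′} {g : Hom B B′} {h : Hom D D′} →
                α⇒ ∘ ((f ⊗₁ g) ⊗₁ h) ≈ (f ⊗₁ (g ⊗₁ h)) ∘ α⇒
    σ-natural : ∀ {A B A′ B′} {f : Hom A A′} {g : Hom B B′} →
                σ ∘ (f ⊗₁ g) ≈ (g ⊗₁ f) ∘ σ
    triangle : ∀ {A B} → (id {A} ⊗₁ λ⇒ {B}) ∘ α⇒ ≈ ρ⇒ ⊗₁ id
    pentagon : ∀ {A B D E} →
               (id {A} ⊗₁ α⇒ {B} {D} {E}) ∘ (α⇒ ∘ (α⇒ ⊗₁ id)) ≈ α⇒ ∘ α⇒
    hexagon  : ∀ {A B D} →
               (id {B} ⊗₁ σ {A} {D}) ∘ (α⇒ ∘ (σ ⊗₁ id)) ≈ α⇒ ∘ (σ ∘ α⇒)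

    copy : ∀ {A} → Hom A (A ⊗₀ A)
    del  : ∀ {A} → Hom A I
    copy-assoc : ∀ {A} → α⇒ ∘ ((copy ⊗₁ id) ∘ copy {A}) ≈ (id ⊗₁ copy) ∘ copy
    copy-unitˡ : ∀ {A} → λ⇒ ∘ ((del ⊗₁ id) ∘ copy {A}) ≈ id
    copy-unitʳ : ∀ {A} → ρ⇒ ∘ ((id ⊗₁ del) ∘ copy {A}) ≈ id
    copy-comm  : ∀ {A} → σ ∘ copy {A} ≈ copy
    copy-⊗ : ∀ {A B} →
             copy {A ⊗₀ B} ≈
             α⇐ ∘ ((id ⊗₁ (α⇒ ∘ ((σ ⊗₁ id) ∘ α⇐))) ∘ (α⇒ ∘ (copy {A} ⊗₁ copy {B})))
    del-⊗  : ∀ {A B} → del {A ⊗₀ B} ≈ λ⇒ ∘ (del {A} ⊗₁ del {B})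
    del-I  : del {I} ≈ id

  dom : ∀ {A X} → Hom A X → Hom A A
  dom f = ρ⇒ ∘ ((id ⊗₁ (del ∘ f)) ∘ copy)

  Normalized : ∀ {A X} → Hom A X → Set e
  Normalized f = f ∘ dom f ≈ f

  Functional : ∀ {A X} → Hom A X → Set e
  Functional f = copy ∘ f ≈ (f ⊗₁ f) ∘ copy

  _⊒_ : ∀ {A X} → Hom A X → Hom A X → Set e
  f ⊒ g = f ∘ dom g ≈ g

record TargetContextCat (o ℓ e p : Level) : Set (suc (o ⊔ ℓ ⊔ e ⊔ p)) where
  field
    gs : GSMonoidal o ℓ e
  open GSMonoidal gs public
  infix 4 _⪰_
  field
    normalized : ∀ {A X} (f : Hom A X) → Normalized f
    T C : Obj
    _⪰_ : ∀ {A} → Rel (Hom A (T ⊗₀ C)) p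
    ⪰-refl  : ∀ {A} {f : Hom A (T ⊗₀ C)} → f ⪰ f
    ⪰-trans : ∀ {A} {f g h : Hom A (T ⊗₀ C)} → f ⪰ g → g ⪰ h → f ⪰ h
    ⊒⇒⪰ : ∀ {A} {f g : Hom A (T ⊗₀ C)} → f ⊒ g → f ⪰ g
    ⪰-∘ : ∀ {A B} {f g : Hom A (T ⊗₀ C)} (h : Hom B A) → f ⪰ g → f ∘ h ⪰ g ∘ h

module TC {o ℓ e p} (𝒞 : TargetContextCat o ℓ e p) where
  open TargetContextCat 𝒞

  record IsSimulator {P : Obj} (s : Hom (P ⊗₀ C) (T ⊗₀ C)) : Set (ℓ ⊔ e) where
    field
      sT : Hom P T
      sC : Hom (P ⊗₀ C) C
      sT-functional : Functional sT
      decomp : s ≈ (sT ⊗₁ sC) ∘ (α⇒ ∘ (copy ⊗₁ id))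
      compile : (id ⊗₁ del) ∘ s ≈ sT ⊗₁ del
      context : λ⇒ ∘ ((del ⊗₁ id) ∘ s) ≈ sC

  LaxReduction : ∀ {P} → Hom (P ⊗₀ C) (T ⊗₀ C) → Hom T P → Set (e ⊔ p)
  LaxReduction s r = Functional r × (s ∘ (r ⊗₁ id) ⪰ id)

  Universal : ∀ {P} → Hom (P ⊗₀ C) (T ⊗₀ C) → Set (ℓ ⊔ e ⊔ p)
  Universal {P} s = Σ (Hom T P) (LaxReduction s)

  Compressed : ∀ {P} {s : Hom (P ⊗₀ C) (T ⊗₀ C)} → IsSimulator s → Set (ℓ ⊔ e ⊔ p)
  Compressed {P} {s} S =
    Universal s ×
    (∀ (r : Hom T P) → LaxReduction s r →
      Σ (Hom I T) λ t → Σ (Hom I T) λ g →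
        Functional t × Functional g ×
        (sT ∘ (r ∘ t) ≈ sT ∘ (r ∘ g)) ×
        ¬ (Σ (Hom C C) λ v → (g ⊗₁ id) ∘ λ⇐ ⪰ (t ⊗₁ v) ∘ λ⇐))
    where open IsSimulator S

  record SimMorphism {P P′ : Obj} (s : Hom (P ⊗₀ C) (T ⊗₀ C))
                     (s′ : Hom (P′ ⊗₀ C) (T ⊗₀ C)) : Set (ℓ ⊔ e ⊔ p) where
    field
      r : Hom P′ P
      q : Hom ((P′ ⊗₀ T) ⊗₀ C) (T ⊗₀ C)
      r-functional : Functional r
      q-simulator  : IsSimulator q
      q-below      : λ⇒ ∘ ((del ⊗₁ id) ∘ α⇒) ⪰ q
      factor       : s′ ≈ q ∘ (α⇐ ∘ ((id ⊗₁ (s ∘ (r ⊗₁ id))) ∘ (α⇒ ∘ (copy ⊗₁ id))))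

  trivial : Hom (T ⊗₀ C) (T ⊗₀ C)
  trivial = id

-- Suppose (r, q) were a simulator morphism from s to the trivial simulator, and write
-- f = s ∘ (r ⊗ id), h = s_T ∘ r.  Since id = q ∘ ⟨x, f x⟩ and q lies below the projection
-- discarding the program x, we get f ⪰ id, so r is a lax reduction and, by hypothesis,
-- id ⪰ f.  Compressedness then gives states t, g with h t = h g that cannot be separated.
-- Comparing compilers in id = q ∘ ⟨x, f x⟩ shows that the compiler of q sends (x, h x) to x.
-- Now feed q the program (t, h t) = (t, h g) together with the context produced by f at g:
-- discarding the first program gives f at g, which lies below g ⊗ id, while q returns
-- t ⊗ v for some v : C → C.  Hence g ⊗ id ⪰ t ⊗ v, contradicting compressedness.
module Submission where

open import Level using (Level)
open import Data.Product using (_,_)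
open import Relation.Binary using (Setoid; IsEquivalence)
open import Relation.Nullary using (¬_)
import Relation.Binary.Reasoning.Setoid as SetoidReasoning

open import Defs

module GSMonoidalProperties {o ℓ e : Level} (𝒢 : GSMonoidal o ℓ e) where
  open GSMonoidal 𝒢

  module ≈ {A B : Obj} = IsEquivalence (≈-equiv {A} {B})

  hom-setoid : Obj → Obj → Setoid ℓ e
  hom-setoid A B = record { Carrier = Hom A B ; _≈_ = _≈_ ; isEquivalence = ≈-equiv }

  module HomReasoning {A B : Obj} = SetoidReasoning (hom-setoid A B)
  open HomReasoning

  ∘-resp-≈ˡ : ∀ {A B D} {f f′ : Hom B D} {g : Hom A B} → f ≈ f′ → f ∘ g ≈ f′ ∘ g
  ∘-resp-≈ˡ p = ∘-resp-≈ p ≈.refl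

  ∘-resp-≈ʳ : ∀ {A B D} {f : Hom B D} {g g′ : Hom A B} → g ≈ g′ → f ∘ g ≈ f ∘ g′
  ∘-resp-≈ʳ p = ∘-resp-≈ ≈.refl p

  ⊗-resp-≈ˡ : ∀ {A B A′ B′} {f f′ : Hom A A′} {g : Hom B B′} → f ≈ f′ → f ⊗₁ g ≈ f′ ⊗₁ g
  ⊗-resp-≈ˡ p = ⊗-resp-≈ p ≈.refl

  ⊗-resp-≈ʳ : ∀ {A B A′ B′} {f : Hom A A′} {g g′ : Hom B B′} → g ≈ g′ → f ⊗₁ g ≈ f ⊗₁ g′
  ⊗-resp-≈ʳ p = ⊗-resp-≈ ≈.refl p

  ⊗-merge : ∀ {A B D A′ B′ D′} {f : Hom B D} {g : Hom A B} {f′ : Hom B′ D′} {g′ : Hom A′ B′} →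
            (f ⊗₁ f′) ∘ (g ⊗₁ g′) ≈ (f ∘ g) ⊗₁ (f′ ∘ g′)
  ⊗-merge = ≈.sym ⊗-∘

  id-comm-sym : ∀ {A B} {f : Hom A B} → id ∘ f ≈ f ∘ id
  id-comm-sym = ≈.trans identityˡ (≈.sym identityʳ)

  pullʳ : ∀ {A B D E} {f : Hom D E} {g : Hom B D} {h : Hom A B} {i : Hom A D} →
          g ∘ h ≈ i → (f ∘ g) ∘ h ≈ f ∘ i
  pullʳ p = ≈.trans assoc (∘-resp-≈ʳ p)

  pullˡ : ∀ {A B D E} {f : Hom D E} {g : Hom B D} {h : Hom A B} {i : Hom B E} →
          f ∘ g ≈ i → f ∘ (g ∘ h) ≈ i ∘ h
  pullˡ p = ≈.trans (≈.sym assoc) (∘-resp-≈ˡ p)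

  id⊗-distrib-∘ : ∀ {A B B′ D} {f : Hom B′ D} {g : Hom B B′} →
                  id {A} ⊗₁ (f ∘ g) ≈ (id ⊗₁ f) ∘ (id ⊗₁ g)
  id⊗-distrib-∘ = ≈.trans (⊗-resp-≈ˡ (≈.sym identityˡ)) ⊗-∘

  ⊗id-distrib-∘ : ∀ {A B B′ D} {f : Hom B′ D} {g : Hom B B′} →
                  (f ∘ g) ⊗₁ id {A} ≈ (f ⊗₁ id) ∘ (g ⊗₁ id)
  ⊗id-distrib-∘ = ≈.trans (⊗-resp-≈ʳ (≈.sym identityˡ)) ⊗-∘

  inverse-square : ∀ {A B A′ B′} {i : Hom A B} {j : Hom B A} {X : Hom B B′} {Y : Hom A A′}
                     {i′ : Hom A′ B′} {j′ : Hom B′ A′} →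
                   j′ ∘ i′ ≈ id → i ∘ j ≈ id → i′ ∘ Y ≈ X ∘ i → j′ ∘ X ≈ Y ∘ j
  inverse-square {i = i} {j} {X} {Y} {i′} {j′} j′i′ ij square = begin
    j′ ∘ X                ≈⟨ ∘-resp-≈ʳ (≈.sym identityʳ) ⟩
    j′ ∘ (X ∘ id)         ≈⟨ ∘-resp-≈ʳ (∘-resp-≈ʳ (≈.sym ij)) ⟩
    j′ ∘ (X ∘ (i ∘ j))    ≈⟨ ∘-resp-≈ʳ (pullˡ (≈.sym square)) ⟩
    j′ ∘ ((i′ ∘ Y) ∘ j)   ≈⟨ ∘-resp-≈ʳ assoc ⟩
    j′ ∘ (i′ ∘ (Y ∘ j))   ≈⟨ pullˡ j′i′ ⟩
    id ∘ (Y ∘ j)          ≈⟨ identityˡ ⟩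
    Y ∘ j                 ∎

  split-epi-cancel : ∀ {A B D} {X Y : Hom B D} {i : Hom A B} {j : Hom B A} →
                     i ∘ j ≈ id → X ∘ i ≈ Y ∘ i → X ≈ Y
  split-epi-cancel {X = X} {Y} {i} {j} ij p = begin
    X             ≈⟨ ≈.sym identityʳ ⟩
    X ∘ id        ≈⟨ ∘-resp-≈ʳ (≈.sym ij) ⟩
    X ∘ (i ∘ j)   ≈⟨ pullˡ p ⟩
    (Y ∘ i) ∘ j   ≈⟨ pullʳ ij ⟩
    Y ∘ id        ≈⟨ identityʳ ⟩
    Y             ∎

  right-inverse-unique : ∀ {A B} {i : Hom A B} {j : Hom B A} {x : Hom B A} →
                         j ∘ i ≈ id → i ∘ x ≈ id → x ≈ j
  right-inverse-unique {i = i} {j} {x} ji ix = begin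
    x             ≈⟨ ≈.sym identityˡ ⟩
    id ∘ x        ≈⟨ ∘-resp-≈ˡ (≈.sym ji) ⟩
    (j ∘ i) ∘ x   ≈⟨ pullʳ ix ⟩
    j ∘ id        ≈⟨ identityʳ ⟩
    j             ∎

  α⇐-natural : ∀ {A B D A′ B′ D′} {f : Hom A A′} {g : Hom B B′} {h : Hom D D′} →
               α⇐ ∘ (f ⊗₁ (g ⊗₁ h)) ≈ ((f ⊗₁ g) ⊗₁ h) ∘ α⇐
  α⇐-natural = inverse-square α-iso₂ α-iso₁ α-natural

  λ⇐-natural : ∀ {A B} {f : Hom A B} → λ⇐ ∘ f ≈ (id ⊗₁ f) ∘ λ⇐
  λ⇐-natural = inverse-square λ-iso₂ λ-iso₁ (≈.sym λ-natural)

  ρ⇐-natural : ∀ {A B} {f : Hom A B} → ρ⇐ ∘ f ≈ (f ⊗₁ id) ∘ ρ⇐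
  ρ⇐-natural = inverse-square ρ-iso₂ ρ-iso₁ (≈.sym ρ-natural)

  λ-conjugate : ∀ {A B} (f : Hom A B) → f ≈ λ⇒ ∘ ((id ⊗₁ f) ∘ λ⇐)
  λ-conjugate f = begin
    f                        ≈⟨ ≈.sym identityʳ ⟩
    f ∘ id                   ≈⟨ ∘-resp-≈ʳ (≈.sym λ-iso₁) ⟩
    f ∘ (λ⇒ ∘ λ⇐)            ≈⟨ pullˡ λ-natural ⟩
    (λ⇒ ∘ (id ⊗₁ f)) ∘ λ⇐    ≈⟨ assoc ⟩
    λ⇒ ∘ ((id ⊗₁ f) ∘ λ⇐)    ∎

  id⊗-injective : ∀ {A B} {f g : Hom A B} → id {I} ⊗₁ f ≈ id ⊗₁ g → f ≈ g
  id⊗-injective {f = f} {g} p = begin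
    f                        ≈⟨ λ-conjugate f ⟩
    λ⇒ ∘ ((id ⊗₁ f) ∘ λ⇐)    ≈⟨ ∘-resp-≈ʳ (∘-resp-≈ˡ p) ⟩
    λ⇒ ∘ ((id ⊗₁ g) ∘ λ⇐)    ≈⟨ ≈.sym (λ-conjugate g) ⟩
    g                        ∎

  -- Both sides, tensored with id_I and precomposed with the invertible
  -- (α⇒ ∘ (α⇒ ⊗ id)), reduce to α⇒ ∘ ((ρ⇒ ⊗ id) ⊗ id): one by the pentagon and the
  -- triangle, the other by naturality of α⇒ and the triangle.
  kelly : ∀ {A B} → λ⇒ {A ⊗₀ B} ∘ α⇒ {I} {A} {B} ≈ λ⇒ ⊗₁ id
  kelly {A} {B} = id⊗-injective (split-epi-cancel ij (≈.trans via-pentagon (≈.sym via-naturality)))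
    where
    i : Hom (((I ⊗₀ I) ⊗₀ A) ⊗₀ B) (I ⊗₀ ((I ⊗₀ A) ⊗₀ B))
    i = α⇒ ∘ (α⇒ ⊗₁ id)
    j : Hom (I ⊗₀ ((I ⊗₀ A) ⊗₀ B)) (((I ⊗₀ I) ⊗₀ A) ⊗₀ B)
    j = (α⇐ ⊗₁ id) ∘ α⇐
    ij : i ∘ j ≈ id
    ij = begin
      (α⇒ ∘ (α⇒ ⊗₁ id)) ∘ ((α⇐ ⊗₁ id) ∘ α⇐)
        ≈⟨ pullʳ (pullˡ (≈.trans ⊗-merge (⊗-resp-≈ α-iso₁ identityˡ))) ⟩
      α⇒ ∘ ((id ⊗₁ id) ∘ α⇐)
        ≈⟨ ∘-resp-≈ʳ (≈.trans (∘-resp-≈ˡ ⊗-id) identityˡ) ⟩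
      α⇒ ∘ α⇐
        ≈⟨ α-iso₁ ⟩
      id ∎
    via-pentagon : (id ⊗₁ (λ⇒ ∘ α⇒)) ∘ i ≈ α⇒ ∘ ((ρ⇒ ⊗₁ id) ⊗₁ id)
    via-pentagon = begin
      (id ⊗₁ (λ⇒ ∘ α⇒)) ∘ i                           ≈⟨ ∘-resp-≈ˡ id⊗-distrib-∘ ⟩
      ((id ⊗₁ λ⇒) ∘ (id ⊗₁ α⇒)) ∘ (α⇒ ∘ (α⇒ ⊗₁ id))   ≈⟨ pullʳ pentagon ⟩
      (id ⊗₁ λ⇒) ∘ (α⇒ ∘ α⇒)                         ≈⟨ pullˡ triangle ⟩
      (ρ⇒ ⊗₁ id) ∘ α⇒                                ≈⟨ ∘-resp-≈ˡ (⊗-resp-≈ʳ (≈.sym ⊗-id)) ⟩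
      (ρ⇒ ⊗₁ (id ⊗₁ id)) ∘ α⇒                        ≈⟨ ≈.sym α-natural ⟩
      α⇒ ∘ ((ρ⇒ ⊗₁ id) ⊗₁ id)                        ∎
    via-naturality : (id ⊗₁ (λ⇒ ⊗₁ id)) ∘ i ≈ α⇒ ∘ ((ρ⇒ ⊗₁ id) ⊗₁ id)
    via-naturality = begin
      (id ⊗₁ (λ⇒ ⊗₁ id)) ∘ (α⇒ ∘ (α⇒ ⊗₁ id))   ≈⟨ pullˡ (≈.sym α-natural) ⟩
      (α⇒ ∘ ((id ⊗₁ λ⇒) ⊗₁ id)) ∘ (α⇒ ⊗₁ id)   ≈⟨ pullʳ (≈.trans ⊗-merge (⊗-resp-≈ triangle identityˡ)) ⟩
      α⇒ ∘ ((ρ⇒ ⊗₁ id) ⊗₁ id)                  ∎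

  λ⇒∘copyᴵ : λ⇒ ∘ copy {I} ≈ id
  λ⇒∘copyᴵ = ≈.trans (∘-resp-≈ʳ insert-del) copy-unitˡ
    where
    insert-del : copy {I} ≈ (del ⊗₁ id) ∘ copy
    insert-del = ≈.sym (≈.trans (∘-resp-≈ˡ (≈.trans (⊗-resp-≈ˡ del-I) ⊗-id)) identityˡ)

  ρ⇒∘copyᴵ : ρ⇒ ∘ copy {I} ≈ id
  ρ⇒∘copyᴵ = ≈.trans (∘-resp-≈ʳ insert-del) copy-unitʳ
    where
    insert-del : copy {I} ≈ (id ⊗₁ del) ∘ copy
    insert-del = ≈.sym (≈.trans (∘-resp-≈ˡ (≈.trans (⊗-resp-≈ʳ del-I) ⊗-id)) identityˡ)

  copyᴵ≈λ⇐ : copy {I} ≈ λ⇐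
  copyᴵ≈λ⇐ = right-inverse-unique λ-iso₂ λ⇒∘copyᴵ

  copyᴵ≈ρ⇐ : copy {I} ≈ ρ⇐
  copyᴵ≈ρ⇐ = right-inverse-unique ρ-iso₂ ρ⇒∘copyᴵ

  scalar-swap : (δ : Hom I I) → (id ⊗₁ δ) ∘ copy ≈ (δ ⊗₁ id) ∘ copy
  scalar-swap δ = begin
    (id ⊗₁ δ) ∘ copy   ≈⟨ ∘-resp-≈ʳ copyᴵ≈λ⇐ ⟩
    (id ⊗₁ δ) ∘ λ⇐     ≈⟨ ≈.sym λ⇐-natural ⟩
    λ⇐ ∘ δ             ≈⟨ ∘-resp-≈ˡ (≈.trans (≈.sym copyᴵ≈λ⇐) copyᴵ≈ρ⇐) ⟩
    ρ⇐ ∘ δ             ≈⟨ ρ⇐-natural ⟩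
    (δ ⊗₁ id) ∘ ρ⇐     ≈⟨ ∘-resp-≈ʳ (≈.sym copyᴵ≈ρ⇐) ⟩
    (δ ⊗₁ id) ∘ copy   ∎

  dom-state : ∀ {X} (t : Hom I X) → dom t ≈ del ∘ t
  dom-state t = begin
    ρ⇒ ∘ ((id ⊗₁ (del ∘ t)) ∘ copy)   ≈⟨ ∘-resp-≈ʳ (scalar-swap (del ∘ t)) ⟩
    ρ⇒ ∘ (((del ∘ t) ⊗₁ id) ∘ copy)   ≈⟨ pullˡ (≈.sym ρ-natural) ⟩
    ((del ∘ t) ∘ ρ⇒) ∘ copy           ≈⟨ pullʳ ρ⇒∘copyᴵ ⟩
    (del ∘ t) ∘ id                    ≈⟨ identityʳ ⟩
    del ∘ t                           ∎

  id-functional : ∀ {X} → Functional (id {X})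
  id-functional = ≈.trans identityʳ (≈.sym (≈.trans (∘-resp-≈ˡ ⊗-id) identityˡ))

  ∘-functional : ∀ {X Y Z} {a : Hom X Y} {b : Hom Y Z} →
                 Functional a → Functional b → Functional (b ∘ a)
  ∘-functional {a = a} {b} fa fb = begin
    copy ∘ (b ∘ a)                ≈⟨ pullˡ fb ⟩
    ((b ⊗₁ b) ∘ copy) ∘ a         ≈⟨ pullʳ fa ⟩
    (b ⊗₁ b) ∘ ((a ⊗₁ a) ∘ copy)  ≈⟨ pullˡ ⊗-merge ⟩
    ((b ∘ a) ⊗₁ (b ∘ a)) ∘ copy   ∎

  middle-swap : ∀ {A B D} → Hom (A ⊗₀ (B ⊗₀ D)) (B ⊗₀ (A ⊗₀ D))
  middle-swap = α⇒ ∘ ((σ ⊗₁ id) ∘ α⇐)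

  middle-swap-natural : ∀ {A B D A′ B′ D′} {a : Hom A A′} {b : Hom B B′} {d : Hom D D′} →
                        middle-swap ∘ (a ⊗₁ (b ⊗₁ d)) ≈ (b ⊗₁ (a ⊗₁ d)) ∘ middle-swap
  middle-swap-natural {a = a} {b} {d} = begin
    (α⇒ ∘ ((σ ⊗₁ id) ∘ α⇐)) ∘ (a ⊗₁ (b ⊗₁ d))
      ≈⟨ pullʳ (pullʳ α⇐-natural) ⟩
    α⇒ ∘ ((σ ⊗₁ id) ∘ (((a ⊗₁ b) ⊗₁ d) ∘ α⇐))
      ≈⟨ ∘-resp-≈ʳ (pullˡ ⊗-merge) ⟩
    α⇒ ∘ (((σ ∘ (a ⊗₁ b)) ⊗₁ (id ∘ d)) ∘ α⇐)
      ≈⟨ ∘-resp-≈ʳ (∘-resp-≈ˡ (≈.trans (⊗-resp-≈ σ-natural id-comm-sym) ⊗-∘)) ⟩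
    α⇒ ∘ ((((b ⊗₁ a) ⊗₁ d) ∘ (σ ⊗₁ id)) ∘ α⇐)
      ≈⟨ ∘-resp-≈ʳ assoc ⟩
    α⇒ ∘ (((b ⊗₁ a) ⊗₁ d) ∘ ((σ ⊗₁ id) ∘ α⇐))
      ≈⟨ pullˡ α-natural ⟩
    ((b ⊗₁ (a ⊗₁ d)) ∘ α⇒) ∘ ((σ ⊗₁ id) ∘ α⇐)
      ≈⟨ assoc ⟩
    (b ⊗₁ (a ⊗₁ d)) ∘ middle-swap ∎

  interchange : ∀ {A A′ B B′} → Hom ((A ⊗₀ A′) ⊗₀ (B ⊗₀ B′)) ((A ⊗₀ B) ⊗₀ (A′ ⊗₀ B′))
  interchange = α⇐ ∘ ((id ⊗₁ middle-swap) ∘ α⇒)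

  interchange-natural : ∀ {A A′ B B′ X X′ Y Y′}
                          {a : Hom A X} {a′ : Hom A′ X′} {b : Hom B Y} {b′ : Hom B′ Y′} →
                        interchange ∘ ((a ⊗₁ a′) ⊗₁ (b ⊗₁ b′)) ≈ ((a ⊗₁ b) ⊗₁ (a′ ⊗₁ b′)) ∘ interchange
  interchange-natural {a = a} {a′} {b} {b′} = begin
    (α⇐ ∘ ((id ⊗₁ middle-swap) ∘ α⇒)) ∘ ((a ⊗₁ a′) ⊗₁ (b ⊗₁ b′))
      ≈⟨ pullʳ (pullʳ α-natural) ⟩
    α⇐ ∘ ((id ⊗₁ middle-swap) ∘ ((a ⊗₁ (a′ ⊗₁ (b ⊗₁ b′))) ∘ α⇒))
      ≈⟨ ∘-resp-≈ʳ (pullˡ ⊗-merge) ⟩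
    α⇐ ∘ (((id ∘ a) ⊗₁ (middle-swap ∘ (a′ ⊗₁ (b ⊗₁ b′)))) ∘ α⇒)
      ≈⟨ ∘-resp-≈ʳ (∘-resp-≈ˡ (≈.trans (⊗-resp-≈ id-comm-sym middle-swap-natural) ⊗-∘)) ⟩
    α⇐ ∘ (((a ⊗₁ (b ⊗₁ (a′ ⊗₁ b′))) ∘ (id ⊗₁ middle-swap)) ∘ α⇒)
      ≈⟨ ∘-resp-≈ʳ assoc ⟩
    α⇐ ∘ ((a ⊗₁ (b ⊗₁ (a′ ⊗₁ b′))) ∘ ((id ⊗₁ middle-swap) ∘ α⇒))
      ≈⟨ pullˡ α⇐-natural ⟩
    (((a ⊗₁ b) ⊗₁ (a′ ⊗₁ b′)) ∘ α⇐) ∘ ((id ⊗₁ middle-swap) ∘ α⇒)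
      ≈⟨ assoc ⟩
    ((a ⊗₁ b) ⊗₁ (a′ ⊗₁ b′)) ∘ interchange ∎

  copy-⊗-interchange : ∀ {A B} → copy {A ⊗₀ B} ≈ interchange ∘ (copy ⊗₁ copy)
  copy-⊗-interchange = ≈.trans copy-⊗ (≈.sym (≈.trans assoc (∘-resp-≈ʳ assoc)))

  ⊗-functional : ∀ {A B X Y} {a : Hom A X} {b : Hom B Y} →
                 Functional a → Functional b → Functional (a ⊗₁ b)
  ⊗-functional {a = a} {b} fa fb = begin
    copy ∘ (a ⊗₁ b)                                     ≈⟨ ∘-resp-≈ˡ copy-⊗-interchange ⟩
    (interchange ∘ (copy ⊗₁ copy)) ∘ (a ⊗₁ b)           ≈⟨ pullʳ ⊗-merge ⟩
    interchange ∘ ((copy ∘ a) ⊗₁ (copy ∘ b))            ≈⟨ ∘-resp-≈ʳ (≈.trans (⊗-resp-≈ fa fb) ⊗-∘) ⟩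
    interchange ∘ (((a ⊗₁ a) ⊗₁ (b ⊗₁ b)) ∘ (copy ⊗₁ copy)) ≈⟨ pullˡ interchange-natural ⟩
    (((a ⊗₁ b) ⊗₁ (a ⊗₁ b)) ∘ interchange) ∘ (copy ⊗₁ copy) ≈⟨ pullʳ (≈.sym copy-⊗-interchange) ⟩
    ((a ⊗₁ b) ⊗₁ (a ⊗₁ b)) ∘ copy                       ∎

  copy-functional : ∀ {X} → Functional (copy {X})
  copy-functional = begin
    copy ∘ copy
      ≈⟨ ∘-resp-≈ˡ copy-⊗-interchange ⟩
    (interchange ∘ (copy ⊗₁ copy)) ∘ copy
      ≈⟨ ≈.trans assoc (pullʳ assoc) ⟩
    α⇐ ∘ ((id ⊗₁ middle-swap) ∘ (α⇒ ∘ ((copy ⊗₁ copy) ∘ copy)))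
      ≈⟨ ∘-resp-≈ʳ (∘-resp-≈ʳ copy³) ⟩
    α⇐ ∘ ((id ⊗₁ middle-swap) ∘ ((id ⊗₁ ((id ⊗₁ copy) ∘ copy)) ∘ copy))
      ≈⟨ ∘-resp-≈ʳ (pullˡ (≈.trans ⊗-merge (⊗-resp-≈ identityˡ swap-invariant))) ⟩
    α⇐ ∘ ((id ⊗₁ ((id ⊗₁ copy) ∘ copy)) ∘ copy)
      ≈⟨ ∘-resp-≈ʳ (≈.sym copy³) ⟩
    α⇐ ∘ (α⇒ ∘ ((copy ⊗₁ copy) ∘ copy))
      ≈⟨ pullˡ α-iso₂ ⟩
    id ∘ ((copy ⊗₁ copy) ∘ copy)
      ≈⟨ identityˡ ⟩
    (copy ⊗₁ copy) ∘ copy ∎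
    where
    copy³ : α⇒ ∘ ((copy ⊗₁ copy) ∘ copy) ≈ (id ⊗₁ ((id ⊗₁ copy) ∘ copy)) ∘ copy
    copy³ = begin
      α⇒ ∘ ((copy ⊗₁ copy) ∘ copy)
        ≈⟨ ∘-resp-≈ʳ (∘-resp-≈ˡ (≈.trans (⊗-resp-≈ (≈.sym (≈.trans (∘-resp-≈ˡ ⊗-id) identityˡ)) (≈.sym identityʳ)) ⊗-∘)) ⟩
      α⇒ ∘ ((((id ⊗₁ id) ⊗₁ copy) ∘ (copy ⊗₁ id)) ∘ copy)
        ≈⟨ ∘-resp-≈ʳ assoc ⟩
      α⇒ ∘ (((id ⊗₁ id) ⊗₁ copy) ∘ ((copy ⊗₁ id) ∘ copy))
        ≈⟨ pullˡ α-natural ⟩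
      ((id ⊗₁ (id ⊗₁ copy)) ∘ α⇒) ∘ ((copy ⊗₁ id) ∘ copy)
        ≈⟨ pullʳ copy-assoc ⟩
      (id ⊗₁ (id ⊗₁ copy)) ∘ ((id ⊗₁ copy) ∘ copy)
        ≈⟨ pullˡ (≈.trans ⊗-merge (⊗-resp-≈ˡ identityˡ)) ⟩
      (id ⊗₁ ((id ⊗₁ copy) ∘ copy)) ∘ copy ∎
    swap-invariant : middle-swap ∘ ((id ⊗₁ copy) ∘ copy) ≈ (id ⊗₁ copy) ∘ copy
    swap-invariant = begin
      (α⇒ ∘ ((σ ⊗₁ id) ∘ α⇐)) ∘ ((id ⊗₁ copy) ∘ copy)
        ≈⟨ pullʳ (pullʳ (∘-resp-≈ʳ (≈.sym copy-assoc))) ⟩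
      α⇒ ∘ ((σ ⊗₁ id) ∘ (α⇐ ∘ (α⇒ ∘ ((copy ⊗₁ id) ∘ copy))))
        ≈⟨ ∘-resp-≈ʳ (∘-resp-≈ʳ (≈.trans (pullˡ α-iso₂) identityˡ)) ⟩
      α⇒ ∘ ((σ ⊗₁ id) ∘ ((copy ⊗₁ id) ∘ copy))
        ≈⟨ ∘-resp-≈ʳ (pullˡ (≈.trans ⊗-merge (⊗-resp-≈ copy-comm identityˡ))) ⟩
      α⇒ ∘ ((copy ⊗₁ id) ∘ copy)
        ≈⟨ copy-assoc ⟩
      (id ⊗₁ copy) ∘ copy ∎

  graph : ∀ {X Y} → Hom X Y → Hom X (X ⊗₀ Y)
  graph h = (id ⊗₁ h) ∘ copy

  graph-functional : ∀ {X Y} {h : Hom X Y} → Functional h → Functional (graph h)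
  graph-functional fh = ∘-functional copy-functional (⊗-functional id-functional fh)

  copyˡ : ∀ {X Y} → Hom (X ⊗₀ Y) (X ⊗₀ (X ⊗₀ Y))
  copyˡ = α⇒ ∘ (copy ⊗₁ id)

  copyˡ-natural : ∀ {X X′ Y Y′} {a : Hom X X′} {y : Hom Y Y′} → Functional a →
                  copyˡ ∘ (a ⊗₁ y) ≈ (a ⊗₁ (a ⊗₁ y)) ∘ copyˡ
  copyˡ-natural {a = a} {y} fa = begin
    (α⇒ ∘ (copy ⊗₁ id)) ∘ (a ⊗₁ y)         ≈⟨ pullʳ ⊗-merge ⟩
    α⇒ ∘ ((copy ∘ a) ⊗₁ (id ∘ y))          ≈⟨ ∘-resp-≈ʳ (≈.trans (⊗-resp-≈ fa id-comm-sym) ⊗-∘) ⟩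
    α⇒ ∘ (((a ⊗₁ a) ⊗₁ y) ∘ (copy ⊗₁ id))  ≈⟨ pullˡ α-natural ⟩
    ((a ⊗₁ (a ⊗₁ y)) ∘ α⇒) ∘ (copy ⊗₁ id)  ≈⟨ assoc ⟩
    (a ⊗₁ (a ⊗₁ y)) ∘ copyˡ                ∎

  copyˡ-counit : ∀ {X Y} → λ⇒ ∘ ((del ⊗₁ id) ∘ copyˡ {X} {Y}) ≈ id
  copyˡ-counit = begin
    λ⇒ ∘ ((del ⊗₁ id) ∘ (α⇒ ∘ (copy ⊗₁ id)))
      ≈⟨ ∘-resp-≈ʳ (pullˡ (∘-resp-≈ˡ (⊗-resp-≈ʳ (≈.sym ⊗-id)))) ⟩
    λ⇒ ∘ (((del ⊗₁ (id ⊗₁ id)) ∘ α⇒) ∘ (copy ⊗₁ id))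
      ≈⟨ ∘-resp-≈ʳ (∘-resp-≈ˡ (≈.sym α-natural)) ⟩
    λ⇒ ∘ ((α⇒ ∘ ((del ⊗₁ id) ⊗₁ id)) ∘ (copy ⊗₁ id))
      ≈⟨ ∘-resp-≈ʳ assoc ⟩
    λ⇒ ∘ (α⇒ ∘ (((del ⊗₁ id) ⊗₁ id) ∘ (copy ⊗₁ id)))
      ≈⟨ ≈.sym assoc ⟩
    (λ⇒ ∘ α⇒) ∘ (((del ⊗₁ id) ⊗₁ id) ∘ (copy ⊗₁ id))
      ≈⟨ ∘-resp-≈ kelly ⊗-merge ⟩
    (λ⇒ ⊗₁ id) ∘ (((del ⊗₁ id) ∘ copy) ⊗₁ (id ∘ id))
      ≈⟨ ⊗-merge ⟩
    (λ⇒ ∘ ((del ⊗₁ id) ∘ copy)) ⊗₁ (id ∘ (id ∘ id))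
      ≈⟨ ⊗-resp-≈ copy-unitˡ (≈.trans identityˡ identityˡ) ⟩
    id ⊗₁ id
      ≈⟨ ⊗-id ⟩
    id ∎

  copyˡ-assoc : ∀ {X Z} → α⇐ ∘ ((id ⊗₁ copyˡ) ∘ copyˡ {X} {Z}) ≈ (copy ⊗₁ id) ∘ copyˡ
  copyˡ-assoc = begin
    α⇐ ∘ ((id ⊗₁ (α⇒ ∘ (copy ⊗₁ id))) ∘ (α⇒ ∘ (copy ⊗₁ id)))
      ≈⟨ ∘-resp-≈ʳ (∘-resp-≈ˡ id⊗-distrib-∘) ⟩
    α⇐ ∘ (((id ⊗₁ α⇒) ∘ (id ⊗₁ (copy ⊗₁ id))) ∘ (α⇒ ∘ (copy ⊗₁ id)))
      ≈⟨ ∘-resp-≈ʳ assoc ⟩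
    α⇐ ∘ ((id ⊗₁ α⇒) ∘ ((id ⊗₁ (copy ⊗₁ id)) ∘ (α⇒ ∘ (copy ⊗₁ id))))
      ≈⟨ ∘-resp-≈ʳ (∘-resp-≈ʳ (pullˡ (≈.sym α-natural))) ⟩
    α⇐ ∘ ((id ⊗₁ α⇒) ∘ ((α⇒ ∘ ((id ⊗₁ copy) ⊗₁ id)) ∘ (copy ⊗₁ id)))
      ≈⟨ ∘-resp-≈ʳ (∘-resp-≈ʳ (pullʳ ⊗-merge)) ⟩
    α⇐ ∘ ((id ⊗₁ α⇒) ∘ (α⇒ ∘ (((id ⊗₁ copy) ∘ copy) ⊗₁ (id ∘ id))))
      ≈⟨ ∘-resp-≈ʳ (∘-resp-≈ʳ (∘-resp-≈ʳ (⊗-resp-≈ (≈.sym copy-assoc) identityˡ))) ⟩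
    α⇐ ∘ ((id ⊗₁ α⇒) ∘ (α⇒ ∘ ((α⇒ ∘ ((copy ⊗₁ id) ∘ copy)) ⊗₁ id)))
      ≈⟨ ∘-resp-≈ʳ (∘-resp-≈ʳ (∘-resp-≈ʳ ⊗id-distrib-∘)) ⟩
    α⇐ ∘ ((id ⊗₁ α⇒) ∘ (α⇒ ∘ ((α⇒ ⊗₁ id) ∘ (((copy ⊗₁ id) ∘ copy) ⊗₁ id))))
      ≈⟨ ∘-resp-≈ʳ (∘-resp-≈ʳ (≈.sym assoc)) ⟩
    α⇐ ∘ ((id ⊗₁ α⇒) ∘ ((α⇒ ∘ (α⇒ ⊗₁ id)) ∘ (((copy ⊗₁ id) ∘ copy) ⊗₁ id)))
      ≈⟨ ∘-resp-≈ʳ (pullˡ pentagon) ⟩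
    α⇐ ∘ ((α⇒ ∘ α⇒) ∘ (((copy ⊗₁ id) ∘ copy) ⊗₁ id))
      ≈⟨ ∘-resp-≈ʳ assoc ⟩
    α⇐ ∘ (α⇒ ∘ (α⇒ ∘ (((copy ⊗₁ id) ∘ copy) ⊗₁ id)))
      ≈⟨ pullˡ α-iso₂ ⟩
    id ∘ (α⇒ ∘ (((copy ⊗₁ id) ∘ copy) ⊗₁ id))
      ≈⟨ identityˡ ⟩
    α⇒ ∘ (((copy ⊗₁ id) ∘ copy) ⊗₁ id)
      ≈⟨ ∘-resp-≈ʳ ⊗id-distrib-∘ ⟩
    α⇒ ∘ (((copy ⊗₁ id) ⊗₁ id) ∘ (copy ⊗₁ id))
      ≈⟨ pullˡ α-natural ⟩
    ((copy ⊗₁ (id ⊗₁ id)) ∘ α⇒) ∘ (copy ⊗₁ id)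
      ≈⟨ ∘-resp-≈ˡ (∘-resp-≈ˡ (⊗-resp-≈ʳ ⊗-id)) ⟩
    ((copy ⊗₁ id) ∘ α⇒) ∘ (copy ⊗₁ id)
      ≈⟨ assoc ⟩
    (copy ⊗₁ id) ∘ copyˡ ∎

  keepˡ : ∀ {X Z W₁ W₂} → Hom (X ⊗₀ Z) (W₁ ⊗₀ W₂) → Hom (X ⊗₀ Z) ((X ⊗₀ W₁) ⊗₀ W₂)
  keepˡ y = α⇐ ∘ ((id ⊗₁ y) ∘ copyˡ)

  discardˡ : ∀ {X W₁ W₂} → Hom ((X ⊗₀ W₁) ⊗₀ W₂) (W₁ ⊗₀ W₂)
  discardˡ = λ⇒ ∘ ((del ⊗₁ id) ∘ α⇒)

  discardˡ-keepˡ : ∀ {X Z W₁ W₂} (y : Hom (X ⊗₀ Z) (W₁ ⊗₀ W₂)) → discardˡ ∘ keepˡ y ≈ y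
  discardˡ-keepˡ y = begin
    (λ⇒ ∘ ((del ⊗₁ id) ∘ α⇒)) ∘ (α⇐ ∘ ((id ⊗₁ y) ∘ copyˡ))
      ≈⟨ pullʳ (pullʳ (≈.trans (pullˡ α-iso₁) identityˡ)) ⟩
    λ⇒ ∘ ((del ⊗₁ id) ∘ ((id ⊗₁ y) ∘ copyˡ))
      ≈⟨ ∘-resp-≈ʳ (pullˡ (≈.trans ⊗-merge (≈.trans (⊗-resp-≈ (≈.sym id-comm-sym) id-comm-sym) ⊗-∘))) ⟩
    λ⇒ ∘ (((id ⊗₁ y) ∘ (del ⊗₁ id)) ∘ copyˡ)
      ≈⟨ ∘-resp-≈ʳ assoc ⟩
    λ⇒ ∘ ((id ⊗₁ y) ∘ ((del ⊗₁ id) ∘ copyˡ))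
      ≈⟨ pullˡ (≈.sym λ-natural) ⟩
    (y ∘ λ⇒) ∘ ((del ⊗₁ id) ∘ copyˡ)
      ≈⟨ pullʳ copyˡ-counit ⟩
    y ∘ id
      ≈⟨ identityʳ ⟩
    y ∎

  graph-copyˡ : ∀ {X Y Z W} {h : Hom X Y} {y : Hom (X ⊗₀ Z) W} →
                (graph h ⊗₁ y) ∘ copyˡ ≈ keepˡ ((h ⊗₁ y) ∘ copyˡ)
  graph-copyˡ {h = h} {y} = ≈.sym (begin
    α⇐ ∘ ((id ⊗₁ ((h ⊗₁ y) ∘ copyˡ)) ∘ copyˡ)
      ≈⟨ ∘-resp-≈ʳ (∘-resp-≈ˡ id⊗-distrib-∘) ⟩
    α⇐ ∘ (((id ⊗₁ (h ⊗₁ y)) ∘ (id ⊗₁ copyˡ)) ∘ copyˡ)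
      ≈⟨ ∘-resp-≈ʳ assoc ⟩
    α⇐ ∘ ((id ⊗₁ (h ⊗₁ y)) ∘ ((id ⊗₁ copyˡ) ∘ copyˡ))
      ≈⟨ pullˡ α⇐-natural ⟩
    (((id ⊗₁ h) ⊗₁ y) ∘ α⇐) ∘ ((id ⊗₁ copyˡ) ∘ copyˡ)
      ≈⟨ pullʳ copyˡ-assoc ⟩
    ((id ⊗₁ h) ⊗₁ y) ∘ ((copy ⊗₁ id) ∘ copyˡ)
      ≈⟨ pullˡ (≈.trans ⊗-merge (⊗-resp-≈ʳ identityʳ)) ⟩
    (graph h ⊗₁ y) ∘ copyˡ ∎)

  keepˡ-⊗ : ∀ {X Y Z W} {h : Hom X Y} {k : Hom Z W} → keepˡ (h ⊗₁ k) ≈ graph h ⊗₁ k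
  keepˡ-⊗ {h = h} {k} = begin
    α⇐ ∘ ((id ⊗₁ (h ⊗₁ k)) ∘ (α⇒ ∘ (copy ⊗₁ id)))       ≈⟨ ∘-resp-≈ʳ (pullˡ (≈.sym α-natural)) ⟩
    α⇐ ∘ ((α⇒ ∘ ((id ⊗₁ h) ⊗₁ k)) ∘ (copy ⊗₁ id))       ≈⟨ ∘-resp-≈ʳ assoc ⟩
    α⇐ ∘ (α⇒ ∘ (((id ⊗₁ h) ⊗₁ k) ∘ (copy ⊗₁ id)))       ≈⟨ ≈.trans (pullˡ α-iso₂) identityˡ ⟩
    ((id ⊗₁ h) ⊗₁ k) ∘ (copy ⊗₁ id)                     ≈⟨ ≈.trans ⊗-merge (⊗-resp-≈ʳ identityʳ) ⟩
    graph h ⊗₁ k                                        ∎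

  scalar-copyˡ : ∀ {X Y Z} {a : Hom I X} {b : Hom (I ⊗₀ Y) Z} (δ : Hom I I) →
                 (a ⊗₁ (b ∘ (δ ⊗₁ id))) ∘ copyˡ ≈ ((a ∘ δ) ⊗₁ b) ∘ copyˡ
  scalar-copyˡ {Y = Y} {a = a} {b} δ = begin
    (a ⊗₁ (b ∘ (δ ⊗₁ id))) ∘ (α⇒ ∘ (copy ⊗₁ id))
      ≈⟨ ∘-resp-≈ˡ (≈.trans (⊗-resp-≈ˡ (≈.sym identityʳ)) ⊗-∘) ⟩
    ((a ⊗₁ b) ∘ (id ⊗₁ (δ ⊗₁ id))) ∘ (α⇒ ∘ (copy ⊗₁ id))
      ≈⟨ pullʳ (pullˡ (≈.sym α-natural)) ⟩
    (a ⊗₁ b) ∘ ((α⇒ ∘ ((id ⊗₁ δ) ⊗₁ id)) ∘ (copy ⊗₁ id))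
      ≈⟨ ∘-resp-≈ʳ (pullʳ ⊗-merge) ⟩
    (a ⊗₁ b) ∘ (α⇒ ∘ (((id ⊗₁ δ) ∘ copy) ⊗₁ (id ∘ id)))
      ≈⟨ ∘-resp-≈ʳ (∘-resp-≈ʳ (⊗-resp-≈ˡ (scalar-swap δ))) ⟩
    (a ⊗₁ b) ∘ (α⇒ ∘ (((δ ⊗₁ id) ∘ copy) ⊗₁ (id ∘ id)))
      ≈⟨ ∘-resp-≈ʳ (∘-resp-≈ʳ ⊗-∘) ⟩
    (a ⊗₁ b) ∘ (α⇒ ∘ (((δ ⊗₁ id {I}) ⊗₁ id {Y}) ∘ (copy ⊗₁ id)))
      ≈⟨ ∘-resp-≈ʳ (≈.trans (pullˡ α-natural) assoc) ⟩
    (a ⊗₁ b) ∘ ((δ ⊗₁ (id {I} ⊗₁ id {Y})) ∘ copyˡ)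
      ≈⟨ pullˡ (≈.trans ⊗-merge (⊗-resp-≈ʳ (≈.trans (∘-resp-≈ʳ ⊗-id) identityʳ))) ⟩
    ((a ∘ δ) ⊗₁ b) ∘ copyˡ ∎

  copyˡ-at-state : ∀ {X X′ Y Z} {x : Hom I X} {a : Hom X X′} {b : Hom (X ⊗₀ Y) Z} → Functional x →
                   ((a ⊗₁ b) ∘ copyˡ) ∘ ((x ⊗₁ id) ∘ λ⇐) ≈ ((a ∘ x) ⊗₁ (b ∘ (x ⊗₁ id))) ∘ (copyˡ ∘ λ⇐)
  copyˡ-at-state {x = x} {a} {b} fx = begin
    ((a ⊗₁ b) ∘ copyˡ) ∘ ((x ⊗₁ id) ∘ λ⇐)              ≈⟨ pullʳ (pullˡ (copyˡ-natural fx)) ⟩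
    (a ⊗₁ b) ∘ (((x ⊗₁ (x ⊗₁ id)) ∘ copyˡ) ∘ λ⇐)       ≈⟨ ∘-resp-≈ʳ assoc ⟩
    (a ⊗₁ b) ∘ ((x ⊗₁ (x ⊗₁ id)) ∘ (copyˡ ∘ λ⇐))       ≈⟨ pullˡ ⊗-merge ⟩
    ((a ∘ x) ⊗₁ (b ∘ (x ⊗₁ id))) ∘ (copyˡ ∘ λ⇐)        ∎

  copyˡᴵ : ∀ {Y} → copyˡ {I} {Y} ≈ id ⊗₁ λ⇐
  copyˡᴵ = begin
    α⇒ ∘ (copy ⊗₁ id)
      ≈⟨ ∘-resp-≈ʳ (⊗-resp-≈ˡ copyᴵ≈ρ⇐) ⟩
    α⇒ ∘ (ρ⇐ ⊗₁ id)
      ≈⟨ ≈.sym identityˡ ⟩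
    id ∘ (α⇒ ∘ (ρ⇐ ⊗₁ id))
      ≈⟨ ∘-resp-≈ˡ (≈.sym (≈.trans ⊗-merge (≈.trans (⊗-resp-≈ identityˡ λ-iso₂) ⊗-id))) ⟩
    ((id ⊗₁ λ⇐) ∘ (id ⊗₁ λ⇒)) ∘ (α⇒ ∘ (ρ⇐ ⊗₁ id))
      ≈⟨ pullʳ (pullˡ triangle) ⟩
    (id ⊗₁ λ⇐) ∘ ((ρ⇒ ⊗₁ id) ∘ (ρ⇐ ⊗₁ id))
      ≈⟨ ∘-resp-≈ʳ (≈.trans ⊗-merge (≈.trans (⊗-resp-≈ ρ-iso₁ identityˡ) ⊗-id)) ⟩
    (id ⊗₁ λ⇐) ∘ id
      ≈⟨ identityʳ ⟩
    id ⊗₁ λ⇐ ∎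

  copyˡ-twice-at-state : ∀ {X Y} {x : Hom I X} → Functional x →
                         copyˡ ∘ (copyˡ ∘ ((x ⊗₁ id {Y}) ∘ λ⇐)) ≈
                         (x ⊗₁ ((x ⊗₁ (x ⊗₁ id)) ∘ (λ⇐ ∘ λ⇐))) ∘ λ⇐
  copyˡ-twice-at-state {x = x} fx = begin
    copyˡ ∘ (copyˡ ∘ ((x ⊗₁ id) ∘ λ⇐))
      ≈⟨ ∘-resp-≈ʳ (≈.trans (pullˡ (copyˡ-natural fx)) assoc) ⟩
    copyˡ ∘ ((x ⊗₁ (x ⊗₁ id)) ∘ (copyˡ ∘ λ⇐))
      ≈⟨ ≈.trans (pullˡ (copyˡ-natural fx)) assoc ⟩
    (x ⊗₁ (x ⊗₁ (x ⊗₁ id))) ∘ (copyˡ ∘ (copyˡ ∘ λ⇐))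
      ≈⟨ ∘-resp-≈ʳ (∘-resp-≈ copyˡᴵ (∘-resp-≈ˡ copyˡᴵ)) ⟩
    (x ⊗₁ (x ⊗₁ (x ⊗₁ id))) ∘ ((id ⊗₁ λ⇐) ∘ ((id ⊗₁ λ⇐) ∘ λ⇐))
      ≈⟨ ∘-resp-≈ʳ (pullˡ (≈.trans ⊗-merge (⊗-resp-≈ˡ identityˡ))) ⟩
    (x ⊗₁ (x ⊗₁ (x ⊗₁ id))) ∘ ((id ⊗₁ (λ⇐ ∘ λ⇐)) ∘ λ⇐)
      ≈⟨ pullˡ (≈.trans ⊗-merge (⊗-resp-≈ˡ identityʳ)) ⟩
    (x ⊗₁ ((x ⊗₁ (x ⊗₁ id)) ∘ (λ⇐ ∘ λ⇐))) ∘ λ⇐ ∎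

  -- Since v = λ⇒ ∘ (del ⊗ v) ∘ copy, the map a ⊗ v factors through a ⊗ del.
  ⊗-del-determines : ∀ {A A′ B Z} {a b : Hom A A′} → a ⊗₁ del {B} ≈ b ⊗₁ del →
                     (v : Hom B Z) → a ⊗₁ v ≈ b ⊗₁ v
  ⊗-del-determines {A} {A′} {a = a} {b} a≈b v = begin
    a ⊗₁ v
      ≈⟨ through-del a ⟩
    (id ⊗₁ λ⇒) ∘ (α⇒ ∘ (((a ⊗₁ del) ⊗₁ v) ∘ (α⇐ ∘ (id ⊗₁ copy))))
      ≈⟨ ∘-resp-≈ʳ (∘-resp-≈ʳ (∘-resp-≈ˡ (⊗-resp-≈ˡ a≈b))) ⟩
    (id ⊗₁ λ⇒) ∘ (α⇒ ∘ (((b ⊗₁ del) ⊗₁ v) ∘ (α⇐ ∘ (id ⊗₁ copy))))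
      ≈⟨ ≈.sym (through-del b) ⟩
    b ⊗₁ v ∎
    where
    v-through-del : v ≈ λ⇒ ∘ ((del ⊗₁ v) ∘ copy)
    v-through-del = begin
      v
        ≈⟨ ≈.sym identityʳ ⟩
      v ∘ id
        ≈⟨ ∘-resp-≈ʳ (≈.sym copy-unitˡ) ⟩
      v ∘ (λ⇒ ∘ ((del ⊗₁ id) ∘ copy))
        ≈⟨ pullˡ λ-natural ⟩
      (λ⇒ ∘ (id ⊗₁ v)) ∘ ((del ⊗₁ id) ∘ copy)
        ≈⟨ pullʳ (pullˡ (≈.trans ⊗-merge (⊗-resp-≈ identityˡ identityʳ))) ⟩
      λ⇒ ∘ ((del ⊗₁ v) ∘ copy) ∎
    through-del : (x : Hom A A′) →
                  x ⊗₁ v ≈ (id ⊗₁ λ⇒) ∘ (α⇒ ∘ (((x ⊗₁ del) ⊗₁ v) ∘ (α⇐ ∘ (id ⊗₁ copy))))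
    through-del x = begin
      x ⊗₁ v
        ≈⟨ ⊗-resp-≈ (≈.sym (≈.trans identityˡ identityʳ)) v-through-del ⟩
      (id ∘ (x ∘ id)) ⊗₁ (λ⇒ ∘ ((del ⊗₁ v) ∘ copy))
        ≈⟨ ≈.trans ⊗-∘ (∘-resp-≈ʳ ⊗-∘) ⟩
      (id ⊗₁ λ⇒) ∘ ((x ⊗₁ (del ⊗₁ v)) ∘ (id ⊗₁ copy))
        ≈⟨ ∘-resp-≈ʳ (∘-resp-≈ˡ reassociate) ⟩
      (id ⊗₁ λ⇒) ∘ ((α⇒ ∘ (((x ⊗₁ del) ⊗₁ v) ∘ α⇐)) ∘ (id ⊗₁ copy))
        ≈⟨ ∘-resp-≈ʳ (pullʳ assoc) ⟩
      (id ⊗₁ λ⇒) ∘ (α⇒ ∘ (((x ⊗₁ del) ⊗₁ v) ∘ (α⇐ ∘ (id ⊗₁ copy)))) ∎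
      where
      reassociate : x ⊗₁ (del ⊗₁ v) ≈ α⇒ ∘ (((x ⊗₁ del) ⊗₁ v) ∘ α⇐)
      reassociate = begin
        x ⊗₁ (del ⊗₁ v)                          ≈⟨ ≈.sym identityʳ ⟩
        (x ⊗₁ (del ⊗₁ v)) ∘ id                   ≈⟨ ∘-resp-≈ʳ (≈.sym α-iso₁) ⟩
        (x ⊗₁ (del ⊗₁ v)) ∘ (α⇒ ∘ α⇐)            ≈⟨ pullˡ (≈.sym α-natural) ⟩
        (α⇒ ∘ ((x ⊗₁ del) ⊗₁ v)) ∘ α⇐            ≈⟨ assoc ⟩
        α⇒ ∘ (((x ⊗₁ del) ⊗₁ v) ∘ α⇐)            ∎

module TargetContextProperties {o ℓ e p : Level} (𝒞 : TargetContextCat o ℓ e p) where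
  open TargetContextCat 𝒞
  open GSMonoidalProperties gs

  ≈⇒⪰ : ∀ {A} {f g : Hom A (T ⊗₀ C)} → f ≈ g → f ⪰ g
  ≈⇒⪰ {g = g} f≈g = ⊒⇒⪰ (≈.trans (∘-resp-≈ˡ f≈g) (normalized g))

  state-normalized : ∀ {X} (t : Hom I X) → t ∘ (del ∘ t) ≈ t
  state-normalized t = ≈.trans (∘-resp-≈ʳ (≈.sym (dom-state t))) (normalized t)

module MorphismToTrivial {o ℓ e p : Level} (𝒞 : TargetContextCat o ℓ e p) where
  open TargetContextCat 𝒞
  open TC 𝒞
  open GSMonoidalProperties gs
  open HomReasoning
  open TargetContextProperties 𝒞

  module _ {P : Obj} {s : Hom (P ⊗₀ C) (T ⊗₀ C)} (S : IsSimulator s) (m : SimMorphism s trivial) where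
    open IsSimulator S
    open SimMorphism m
    module Q = IsSimulator q-simulator

    h : Hom T T
    h = sT ∘ r

    c : Hom (T ⊗₀ C) C
    c = sC ∘ (r ⊗₁ id)

    reduced-decomposition : s ∘ (r ⊗₁ id) ≈ (h ⊗₁ c) ∘ copyˡ
    reduced-decomposition = begin
      s ∘ (r ⊗₁ id)                                  ≈⟨ ∘-resp-≈ˡ decomp ⟩
      ((sT ⊗₁ sC) ∘ copyˡ) ∘ (r ⊗₁ id)               ≈⟨ pullʳ (copyˡ-natural r-functional) ⟩
      (sT ⊗₁ sC) ∘ ((r ⊗₁ (r ⊗₁ id)) ∘ copyˡ)        ≈⟨ pullˡ ⊗-merge ⟩
      (h ⊗₁ c) ∘ copyˡ                               ∎

    reduced-compile : (h ⊗₁ (del ∘ c)) ∘ copyˡ ≈ h ⊗₁ del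
    reduced-compile = begin
      (h ⊗₁ (del ∘ c)) ∘ copyˡ
        ≈⟨ ∘-resp-≈ˡ (≈.trans (⊗-resp-≈ʳ (≈.sym assoc)) ⊗-∘) ⟩
      ((sT ⊗₁ (del ∘ sC)) ∘ (r ⊗₁ (r ⊗₁ id))) ∘ copyˡ
        ≈⟨ pullʳ (≈.sym (copyˡ-natural r-functional)) ⟩
      (sT ⊗₁ (del ∘ sC)) ∘ (copyˡ ∘ (r ⊗₁ id))
        ≈⟨ pullˡ (≈.sym compile-s) ⟩
      ((id ⊗₁ del) ∘ s) ∘ (r ⊗₁ id)
        ≈⟨ ∘-resp-≈ˡ compile ⟩
      (sT ⊗₁ del) ∘ (r ⊗₁ id)
        ≈⟨ ≈.trans ⊗-merge (⊗-resp-≈ʳ identityʳ) ⟩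
      h ⊗₁ del ∎
      where
      compile-s : (id ⊗₁ del) ∘ s ≈ (sT ⊗₁ (del ∘ sC)) ∘ copyˡ
      compile-s = ≈.trans (∘-resp-≈ʳ decomp) (pullˡ (≈.trans ⊗-merge (⊗-resp-≈ˡ identityˡ)))

    reduction-lax : s ∘ (r ⊗₁ id) ⪰ id
    reduction-lax = ⪰-trans (≈⇒⪰ (≈.sym (discardˡ-keepˡ _)))
                   (⪰-trans (⪰-∘ (keepˡ (s ∘ (r ⊗₁ id))) q-below) (≈⇒⪰ (≈.sym factor)))

    keepˡ-reduced : keepˡ (s ∘ (r ⊗₁ id)) ≈ (graph h ⊗₁ c) ∘ copyˡ
    keepˡ-reduced = ≈.trans (∘-resp-≈ʳ (∘-resp-≈ˡ (⊗-resp-≈ʳ reduced-decomposition))) (≈.sym graph-copyˡ)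

    q-compiler-on-graph : (Q.sT ∘ graph h) ⊗₁ del {C} ≈ id ⊗₁ del
    q-compiler-on-graph = ≈.sym (begin
      id ⊗₁ del
        ≈⟨ ≈.sym identityʳ ⟩
      (id ⊗₁ del) ∘ id
        ≈⟨ ∘-resp-≈ʳ factor ⟩
      (id ⊗₁ del) ∘ (q ∘ keepˡ (s ∘ (r ⊗₁ id)))
        ≈⟨ pullˡ Q.compile ⟩
      (Q.sT ⊗₁ del) ∘ keepˡ (s ∘ (r ⊗₁ id))
        ≈⟨ ∘-resp-≈ʳ keepˡ-reduced ⟩
      (Q.sT ⊗₁ del) ∘ ((graph h ⊗₁ c) ∘ copyˡ)
        ≈⟨ pullˡ (≈.trans ⊗-merge (≈.trans (⊗-resp-≈ʳ (≈.sym identityˡ)) ⊗-∘)) ⟩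
      ((Q.sT ⊗₁ id) ∘ (graph h ⊗₁ (del ∘ c))) ∘ copyˡ
        ≈⟨ pullʳ graph-copyˡ ⟩
      (Q.sT ⊗₁ id) ∘ keepˡ ((h ⊗₁ (del ∘ c)) ∘ copyˡ)
        ≈⟨ ∘-resp-≈ʳ (∘-resp-≈ʳ (∘-resp-≈ˡ (⊗-resp-≈ʳ reduced-compile))) ⟩
      (Q.sT ⊗₁ id) ∘ keepˡ (h ⊗₁ del)
        ≈⟨ ∘-resp-≈ʳ keepˡ-⊗ ⟩
      (Q.sT ⊗₁ id) ∘ (graph h ⊗₁ del)
        ≈⟨ ≈.trans ⊗-merge (⊗-resp-≈ʳ identityˡ) ⟩
      (Q.sT ∘ graph h) ⊗₁ del ∎)

    module _ {t g : Hom I T} (t-functional : Functional t) (g-functional : Functional g)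
             (collision : sT ∘ (r ∘ t) ≈ sT ∘ (r ∘ g)) where

      context-at-g : Hom (T ⊗₀ C) C
      context-at-g = (c ∘ (g ⊗₁ id)) ∘ (del ⊗₁ id)

      input : Hom C ((T ⊗₀ T) ⊗₀ C)
      input = ((graph h ⊗₁ context-at-g) ∘ copyˡ) ∘ ((t ⊗₁ id) ∘ λ⇐)

      discardˡ-input : discardˡ ∘ input ≈ (s ∘ (r ⊗₁ id)) ∘ ((g ⊗₁ id) ∘ λ⇐)
      discardˡ-input = begin
        discardˡ ∘ input
          ≈⟨ pullˡ (≈.trans (∘-resp-≈ʳ graph-copyˡ) (discardˡ-keepˡ _)) ⟩
        ((h ⊗₁ context-at-g) ∘ copyˡ) ∘ ((t ⊗₁ id) ∘ λ⇐)
          ≈⟨ copyˡ-at-state t-functional ⟩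
        ((h ∘ t) ⊗₁ (context-at-g ∘ (t ⊗₁ id))) ∘ (copyˡ ∘ λ⇐)
          ≈⟨ ∘-resp-≈ˡ (⊗-resp-≈ʳ (pullʳ (≈.trans ⊗-merge (⊗-resp-≈ʳ identityˡ)))) ⟩
        ((h ∘ t) ⊗₁ ((c ∘ (g ⊗₁ id)) ∘ ((del ∘ t) ⊗₁ id))) ∘ (copyˡ ∘ λ⇐)
          ≈⟨ ≈.trans (pullˡ (scalar-copyˡ (del ∘ t))) assoc ⟩
        (((h ∘ t) ∘ (del ∘ t)) ⊗₁ (c ∘ (g ⊗₁ id))) ∘ (copyˡ ∘ λ⇐)
          ≈⟨ ∘-resp-≈ˡ (⊗-resp-≈ˡ (≈.trans (pullʳ (state-normalized t)) h-collides)) ⟩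
        ((h ∘ g) ⊗₁ (c ∘ (g ⊗₁ id))) ∘ (copyˡ ∘ λ⇐)
          ≈⟨ ≈.sym (copyˡ-at-state g-functional) ⟩
        ((h ⊗₁ c) ∘ copyˡ) ∘ ((g ⊗₁ id) ∘ λ⇐)
          ≈⟨ ∘-resp-≈ˡ (≈.sym reduced-decomposition) ⟩
        (s ∘ (r ⊗₁ id)) ∘ ((g ⊗₁ id) ∘ λ⇐) ∎
        where
        h-collides : h ∘ t ≈ h ∘ g
        h-collides = ≈.trans assoc (≈.trans collision (≈.sym assoc))

      output-context : Hom C C
      output-context = (Q.sC ∘ (graph h ⊗₁ context-at-g)) ∘ ((t ⊗₁ (t ⊗₁ id)) ∘ (λ⇐ ∘ λ⇐))

      q-input : q ∘ input ≈ (t ⊗₁ output-context) ∘ λ⇐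
      q-input = begin
        q ∘ input
          ≈⟨ ∘-resp-≈ˡ Q.decomp ⟩
        ((Q.sT ⊗₁ Q.sC) ∘ copyˡ) ∘ (((graph h ⊗₁ context-at-g) ∘ copyˡ) ∘ ((t ⊗₁ id) ∘ λ⇐))
          ≈⟨ pullʳ (≈.trans (pullˡ (pullˡ (copyˡ-natural graph-h-functional))) (≈.trans assoc assoc)) ⟩
        (Q.sT ⊗₁ Q.sC) ∘ ((graph h ⊗₁ (graph h ⊗₁ context-at-g)) ∘ (copyˡ ∘ (copyˡ ∘ ((t ⊗₁ id) ∘ λ⇐))))
          ≈⟨ pullˡ ⊗-merge ⟩
        (φ ⊗₁ ψ) ∘ (copyˡ ∘ (copyˡ ∘ ((t ⊗₁ id) ∘ λ⇐)))
          ≈⟨ ∘-resp-≈ʳ (copyˡ-twice-at-state t-functional) ⟩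
        (φ ⊗₁ ψ) ∘ ((t ⊗₁ ((t ⊗₁ (t ⊗₁ id)) ∘ (λ⇐ ∘ λ⇐))) ∘ λ⇐)
          ≈⟨ pullˡ ⊗-merge ⟩
        ((φ ∘ t) ⊗₁ output-context) ∘ λ⇐
          ≈⟨ ∘-resp-≈ˡ (≈.trans (⊗-resp-≈ʳ (≈.sym identityʳ)) ⊗-∘) ⟩
        ((φ ⊗₁ output-context) ∘ (t ⊗₁ id)) ∘ λ⇐
          ≈⟨ ∘-resp-≈ˡ (∘-resp-≈ˡ (⊗-del-determines q-compiler-on-graph output-context)) ⟩
        ((id ⊗₁ output-context) ∘ (t ⊗₁ id)) ∘ λ⇐
          ≈⟨ ∘-resp-≈ˡ (≈.trans ⊗-merge (⊗-resp-≈ identityˡ identityʳ)) ⟩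
        (t ⊗₁ output-context) ∘ λ⇐ ∎
        where
        φ : Hom T T
        φ = Q.sT ∘ graph h
        ψ : Hom (T ⊗₀ (T ⊗₀ C)) C
        ψ = Q.sC ∘ (graph h ⊗₁ context-at-g)
        graph-h-functional : Functional (graph h)
        graph-h-functional = graph-functional (∘-functional r-functional sT-functional)

      separation : id ⪰ s ∘ (r ⊗₁ id) → (g ⊗₁ id) ∘ λ⇐ ⪰ (t ⊗₁ output-context) ∘ λ⇐
      separation id⪰reduced =
        ⪰-trans (≈⇒⪰ (≈.sym identityˡ))
        (⪰-trans (⪰-∘ ((g ⊗₁ id) ∘ λ⇐) id⪰reduced)
        (⪰-trans (≈⇒⪰ (≈.sym discardˡ-input))
        (⪰-trans (⪰-∘ input q-below) (≈⇒⪰ q-input))))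

mainTheorem3 : ∀ {o ℓ e p} (𝒞 : TargetContextCat o ℓ e p) →
    let open TargetContextCat 𝒞 in let open TC 𝒞 in
    ∀ {P : Obj} (s : Hom (P ⊗₀ C) (T ⊗₀ C)) (S : IsSimulator s) →
    (∀ (r : Hom T P) → Functional r → s ∘ (r ⊗₁ id) ⪰ id → id ⪰ s ∘ (r ⊗₁ id)) →
    Compressed S →
    ¬ SimMorphism s trivial
mainTheorem3 𝒞 s S tight (_ , compressed) m =
  let t , g , t-functional , g-functional , collision , inseparable =
        compressed r (r-functional , reduction-lax S m)
  in inseparable (_ , separation S m t-functional g-functional collision
                                 (tight r r-functional (reduction-lax S m)))
  where
  open TC 𝒞 using (module SimMorphism)
  open SimMorphism m using (r; r-functional)
  open MorphismToTrivial 𝒞
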